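{- Let $\tau$ be a correct translation SYNCSIMPLE $\to$ LOCKSIMPLE$_{1,IS}$. Then $\tau(!)$ as well as $\tau(?)$ either start with $P_1$ or have a subsequence $P_1P_1$.
   Context: SYNCSIMPLE: subprocesses $U ::= \checkmark \mid 0 \mid\ !U \mid\ ?U$; processes are parallel compositions (multisets) of subprocesses; reduction $!U_1 \mid ?U_2 \mid P \to U_1 \mid U_2 \mid P$; successful = has a parallel component $\checkmark$; may-convergent = reduces to a successful process; must-convergent = every reduct is may-convergent. LOCKSIMPLE$_{1,IS}$: one lock $C_1$, full ($\blacksquare$) or empty ($\Box$), initial store $IS$; subprocesses $U ::= 0 \mid \checkmark \mid P_1U \mid T_1U$; $P_1$ on an empty lock fills it, on a full lock blocks; $T_1$ never blocks and empties the lock. Convergence evaluated from $(P,IS)$. $\tau$ is compositional ($\tau(0)=0$, $\tau(\checkmark)=\checkmark$, $\tau$ commutes with parallel composition, $\tau(!U)=\tau(!)\tau(U)$, $\tau(?U)=\tau(?)\tau(U)$, with $\tau(!),\tau(?)$ strings over $\{P_1,T_1\}$); correct = preserve and reflect may- and must-convergence. "Subsequence $P_1P_1$" means two consecutive occurrences of $P_1$. -}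

module Defs where

open import Data.List using (List; []; _∷_; _++_; map)
open import Data.List.Membership.Propositional using (_∈_)
open import Data.List.Relation.Binary.Permutation.Propositional using (_↭_)
open import Data.Product using (Σ; ∃; _×_; _,_)
open import Data.Sum using (_⊎_)
open import Relation.Binary.PropositionalEquality using (_≡_)
open import Relation.Binary.Construct.Closure.ReflexiveTransitive using (Star)
open import Function.Bundles using (_⇔_)

data SU : Set where
  ✓  : SU
  𝟘  : SU
  !_ : SU → SU
  ¿_ : SU → SU        -- the input prefix ?U

-- processes: parallel compositions (multisets) of subprocesses,
-- represented as lists, taken up to permutation in the reduction
SProc : Set
SProc = List SU

data _⟶S_ : SProc → SProc → Set where
  sync : ∀ {P} U₁ U₂ R → P ↭ (! U₁ ∷ ¿ U₂ ∷ R) → P ⟶S (U₁ ∷ U₂ ∷ R)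

_⟶S*_ : SProc → SProc → Set
_⟶S*_ = Star _⟶S_

SSuccessful : SProc → Set
SSuccessful P = ✓ ∈ P

SMay : SProc → Set
SMay P = ∃ λ Q → P ⟶S* Q × SSuccessful Q

SMust : SProc → Set
SMust P = ∀ Q → P ⟶S* Q → SMay Q

data Act : Set where
  P₁ T₁ : Act

data Lock : Set where
  ■ □ : Lock    -- full, empty

data LU : Set where
  𝟘  : LU
  ✓  : LU
  _·_ : Act → LU → LU

LProc : Set
LProc = List LU

Conf : Set
Conf = LProc × Lock

data _⟶L_ : Conf → Conf → Set where
  -- P₁ on an empty lock fills it (blocks on a full lock: no rule)
  put  : ∀ {P} U R → P ↭ (P₁ · U ∷ R) → (P , □) ⟶L (U ∷ R , ■)
  take : ∀ {P} U R s → P ↭ (T₁ · U ∷ R) → (P , s) ⟶L (U ∷ R , □)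

_⟶L*_ : Conf → Conf → Set
_⟶L*_ = Star _⟶L_

LSuccessful : Conf → Set
LSuccessful (P , _) = ✓ ∈ P

LMay : Conf → Set
LMay c = ∃ λ d → c ⟶L* d × LSuccessful d

LMust : Conf → Set
LMust c = ∀ d → c ⟶L* d → LMay d

-- Compositional translations SYNCSIMPLE → LOCKSIMPLE_{1,IS}
-- determined by the strings τ(!) and τ(?)

record Translation : Set where
  constructor mkτ
  field
    τ! : List Act
    τ? : List Act

prefix : List Act → LU → LU
prefix []       U = U
prefix (a ∷ as) U = a · prefix as U

τU : Translation → SU → LU
τU τ ✓       = ✓
τU τ 𝟘       = 𝟘
τU τ (! U)   = prefix (Translation.τ! τ) (τU τ U)
τU τ (¿ U)   = prefix (Translation.τ? τ) (τU τ U)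

τP : Translation → SProc → LProc
τP τ = map (τU τ)

Correct : Lock → Translation → Set
Correct IS τ = ∀ (P : SProc) →
  (SMay P ⇔ LMay (τP τ P , IS)) × (SMust P ⇔ LMust (τP τ P , IS))

StartsWithP₁ : List Act → Set
StartsWithP₁ w = ∃ λ ys → w ≡ P₁ ∷ ys

HasP₁P₁ : List Act → Set
HasP₁P₁ w = ∃ λ xs → ∃ λ ys → w ≡ xs ++ (P₁ ∷ P₁ ∷ ys)

-- A lone !✓ (or ?✓) has no partner, so it never reduces and is not may-convergent;
-- a correct translation must therefore keep the lone thread τ(!)✓ from reaching ✓.
-- Executed on its own, a thread only gets stuck when P₁ meets a full lock. The lock
-- is full either initially (then the stuck P₁ is the first action) or because the
-- immediately preceding action was a P₁ (T₁ always empties it), giving P₁P₁.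
module Submission where

open import Defs
open import Data.Empty using (⊥-elim)
open import Data.List using (List; []; _∷_; [_])
open import Data.List.Relation.Unary.Any using (here; there)
open import Data.List.Relation.Binary.Permutation.Propositional using (↭-refl)
open import Data.List.Relation.Binary.Permutation.Propositional.Properties using (↭-length)
open import Data.Product using (_×_; _,_; ∃; proj₁; proj₂)
open import Data.Sum using (_⊎_; inj₁; inj₂)
open import Function.Bundles using (Equivalence)
open import Relation.Binary.Construct.Closure.ReflexiveTransitive using (ε; _◅_)
open import Relation.Binary.PropositionalEquality using (_≡_; _≢_; refl; sym; cong)
open import Relation.Nullary using (¬_)

lone-irreducible : ∀ {V Q} → ¬ ([ V ] ⟶S Q)
lone-irreducible (sync _ _ _ p) with ↭-length p
... | ()

¬SMay-lone : ∀ V → V ≢ ✓ → ¬ SMay [ V ]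
¬SMay-lone V V≢✓ (_ , ε , here ✓≡V) = V≢✓ (sym ✓≡V)
¬SMay-lone V V≢✓ (_ , step ◅ _ , _) = lone-irreducible step

correct⇒¬LMay : ∀ {IS τ P} → Correct IS τ → ¬ SMay P → ¬ LMay (τP τ P , IS)
correct⇒¬LMay {P = P} correct ¬may = λ may → ¬may (Equivalence.from (proj₁ (correct P)) may)

RunsFrom : Lock → List Act → LU → Set
RunsFrom s w U = ∃ λ s′ → ([ prefix w U ] , s) ⟶L* ([ U ] , s′)

BlockedAt : Lock → List Act → Set
BlockedAt s w = s ≡ ■ × StartsWithP₁ w

HasP₁P₁-∷ : ∀ a {w} → HasP₁P₁ w → HasP₁P₁ (a ∷ w)
HasP₁P₁-∷ a (xs , ys , w≡) = a ∷ xs , ys , cong (a ∷_) w≡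

lone-run : ∀ s w U → BlockedAt s w ⊎ HasP₁P₁ w ⊎ RunsFrom s w U
lone-run s [] U = inj₂ (inj₂ (s , ε))
lone-run s (T₁ ∷ w) U with lone-run □ w U
... | inj₁ (() , _)
... | inj₂ (inj₁ has) = inj₂ (inj₁ (HasP₁P₁-∷ T₁ has))
... | inj₂ (inj₂ (s′ , run)) = inj₂ (inj₂ (s′ , take _ [] s ↭-refl ◅ run))
lone-run ■ (P₁ ∷ w) U = inj₁ (refl , w , refl)
lone-run □ (P₁ ∷ w) U with lone-run ■ w U
... | inj₁ (_ , ys , w≡) = inj₂ (inj₁ ([] , ys , cong (P₁ ∷_) w≡))
... | inj₂ (inj₁ has) = inj₂ (inj₁ (HasP₁P₁-∷ P₁ has))
... | inj₂ (inj₂ (s′ , run)) = inj₂ (inj₂ (s′ , put _ [] ↭-refl ◅ run))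

¬LMay-lone⇒guarded : ∀ IS w → ¬ LMay ([ prefix w ✓ ] , IS) → StartsWithP₁ w ⊎ HasP₁P₁ w
¬LMay-lone⇒guarded IS w ¬may with lone-run IS w ✓
... | inj₁ (_ , starts) = inj₁ starts
... | inj₂ (inj₁ has) = inj₂ has
... | inj₂ (inj₂ (_ , run)) = ⊥-elim (¬may (_ , run , here refl))

lemma3p1 : (IS : Lock) (τ : Translation) → Correct IS τ →
    (StartsWithP₁ (Translation.τ! τ) ⊎ HasP₁P₁ (Translation.τ! τ))
    × (StartsWithP₁ (Translation.τ? τ) ⊎ HasP₁P₁ (Translation.τ? τ))
lemma3p1 IS τ correct =
    ¬LMay-lone⇒guarded IS _ (correct⇒¬LMay correct (¬SMay-lone (! ✓) λ ()))
  , ¬LMay-lone⇒guarded IS _ (correct⇒¬LMay correct (¬SMay-lone (¿ ✓) λ ()))
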